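{- For every $n\ge1$ and every $S\subseteq[n]$, $$|\{e\in\mathbf{I}_n:\mathrm{Em}^*(1\underline{01},e)=S\}|=|\{e\in\mathbf{I}_n:\mathrm{Em}^*(1\underline{10},e)=S\}|.$$
   Context: $\mathbf{I}_n$ is the set of integer sequences $e_1\dots e_n$ with $0\le e_i<i$. For $e\in\mathbf{I}_n$, $\mathrm{Em}^*(1\underline{01},e)$ is the set of $i\in[n-1]$ for which there exists $t<i$ with $e_i<e_{i+1}=e_t$, and $\mathrm{Em}^*(1\underline{10},e)$ is the set of $i\in[n-1]$ for which there exists $t<i$ with $e_t=e_i>e_{i+1}$. -}

module Defs where

open import Data.Bool using (Bool; true; false; _∧_; if_then_else_)
open import Data.Nat using (ℕ; zero; suc; _<ᵇ_; _≡ᵇ_; _≤_)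
open import Data.Fin using (Fin; toℕ)
open import Data.Fin.Subset using (Subset)
open import Data.List using (List; []; _∷_; map; concatMap; upTo; filterᵇ; length)
open import Data.Bool.ListAction using (any)
open import Data.Vec using (Vec; []; _∷_; tabulate; toList)
import Data.Vec.Properties as VecP
import Data.Bool.Properties as BoolP
open import Relation.Nullary using (does)

-- Sequences are stored 0-indexed: position j (0 ≤ j < n) holds e_{j+1}.

allVecs : (n b : ℕ) → List (Vec ℕ n)
allVecs zero    b = [] ∷ []
allVecs (suc n) b = concatMap (λ x → map (x ∷_) (allVecs n b)) (upTo b)

at : List ℕ → ℕ → ℕ
at []       _       = 0
at (x ∷ xs) zero    = x
at (x ∷ xs) (suc j) = at xs j

isInvL : ℕ → List ℕ → Bool
isInvL j []       = true
isInvL j (x ∷ xs) = (x <ᵇ suc j) ∧ isInvL (suc j) xs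

isInv : ∀ {n} → Vec ℕ n → Bool
isInv e = isInvL 0 (toList e)

-- I_n : all inversion sequences of length n (entries < n suffice, since e_i < i ≤ n)
Inv : (n : ℕ) → List (Vec ℕ n)
Inv n = filterᵇ isInv (allVecs n n)

-- Em*(1 01, e): index k : Fin n stands for i = k+1 ∈ [n];
-- i ∈ Em* iff i ≤ n-1 and ∃ t < i with e_i < e_{i+1} = e_t.
-- (0-indexed: k+1 < n, ∃ t < k with e[k] < e[k+1] = e[t].)
em01 : ∀ {n} → Vec ℕ n → Subset n
em01 {n} e = tabulate λ k →
  let l = toList e ; j = toℕ k ; a = at l j ; b = at l (suc j) in
  (suc j <ᵇ n) ∧ (a <ᵇ b) ∧ any (λ t → at l t ≡ᵇ b) (upTo j)

-- Em*(1 10, e): i ∈ Em* iff i ≤ n-1 and ∃ t < i with e_t = e_i > e_{i+1}.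
em10 : ∀ {n} → Vec ℕ n → Subset n
em10 {n} e = tabulate λ k →
  let l = toList e ; j = toℕ k ; a = at l j ; b = at l (suc j) in
  (suc j <ᵇ n) ∧ (b <ᵇ a) ∧ any (λ t → at l t ≡ᵇ a) (upTo j)

_≟S_ : ∀ {n} → Subset n → Subset n → Bool
S ≟S T = does (VecP.≡-dec BoolP._≟_ S T)

count01 : (n : ℕ) → Subset n → ℕ
count01 n S = length (filterᵇ (λ e → em01 e ≟S S) (Inv n))

count10 : (n : ℕ) → Subset n → ℕ
count10 n S = length (filterᵇ (λ e → em10 e ≟S S) (Inv n))

module Submission where

-- By inclusion–exclusion over the subsets of [n] (module Inversion) it is
-- enough to show, for every B ⊆ [n], that B ⊆ Em*(1 01, e) and
-- B ⊆ Em*(1 10, e) have equally many solutions e ∈ I_n.  Maximal runs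
-- i, i+1, …, i+r of consecutive elements of B cut the positions of e into
-- blocks {i, …, i+r+1} (module Blocks).  If B ⊆ Em*(1 01, e), then e
-- increases strictly along each block and every entry of a block after the
-- first repeats a value occurring before the block; reversing all blocks
-- produces the mirror image, B ⊆ Em*(1 10, ·), and keeps the inversion
-- sequence condition because all values of a non-trivial block are smaller
-- than its first position (module Reversal).  The converse holds in the same
-- way, and block reversal is an involution, so it exchanges the two sets
-- (lemma count-involution).

open import Defs
open import Data.Bool using (Bool; true; false; T; _∧_; if_then_else_)
open import Data.Bool.ListAction using (any)
open import Data.Bool.Properties using (T?; T-∧; T-≡) renaming (_≟_ to _≟ᵇ_)
open import Data.Fin using (Fin; toℕ; fromℕ<; zero; suc)
open import Data.Fin.Properties using (toℕ-fromℕ<; toℕ<n)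
open import Data.Fin.Subset using (Subset; _∈_; _∉_; _⊆_; _∪_; ⁅_⁆)
open import Data.Fin.Subset.Properties using (_⊆?_; _∈?_; ⊆-antisym; p⊆p∪q; q⊆p∪q; x∈p∪q⁻; x∈⁅x⁆; x∈⁅y⁆⇒x≡y)
open import Data.List using (List; []; _∷_; length; filter; filterᵇ; map; _++_; concatMap; cartesianProductWith; upTo; allFin)
open import Data.List.Properties using (filter-≐; length-map)
open import Data.List.Membership.Propositional using (find; lose) renaming (_∈_ to _∈ˡ_)
open import Data.List.Membership.Propositional.Properties
  using (∈-filter⁺; ∈-filter⁻; ∈-map⁺; ∈-map⁻; ∈-allFin; ∈-upTo⁺; ∈-upTo⁻; ∈-cartesianProductWith⁺)
open import Data.List.Membership.Propositional.Properties.WithK using (unique∧set⇒bag)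
open import Data.List.Relation.Binary.BagAndSetEquality using (∼bag⇒↭)
open import Data.List.Relation.Binary.Permutation.Propositional.Properties using (↭-length)
open import Data.List.Relation.Unary.All as All using (All; []; _∷_; all?)
open import Data.List.Relation.Unary.AllPairs using ([]; _∷_)
import Data.List.Relation.Unary.Any as Any
open import Data.List.Relation.Unary.Any.Properties using (any⁺; any⁻)
open import Data.List.Relation.Unary.Unique.Propositional using (Unique)
import Data.List.Relation.Unary.Unique.Propositional.Properties as Unique
open import Data.Nat using (ℕ; zero; suc; _+_; _∸_; _≤_; _<_; z≤n; s≤s; _<ᵇ_; _≡ᵇ_)
open import Data.Nat.Properties
  using ( +-suc; +-cancelˡ-≡; +-identityʳ; +-∸-assoc; m+n∸m≡n; m∸[m∸n]≡n; ∸-monoʳ-≤; m≤n+m; m≤m+n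
        ; n≤1+n; ≤-trans; ≤-refl; ≤-pred; ≤-antisym; <⇒≤; <⇒≱; ≮⇒≥; ≤∧≢⇒<; <-≤-trans; ≤-<-trans
        ; <-trans; <-cmp; m≤n⇒m<n∨m≡n; n≮n; _<?_; <ᵇ⇒<; <⇒<ᵇ; ≡ᵇ⇒≡; ≡⇒≡ᵇ; m+n∸n≡m )
open import Data.Product using (∃; _×_; _,_; proj₁; proj₂)
open import Data.Sum using (inj₁; inj₂)
open import Data.Unit using (⊤)
open import Data.Vec using (Vec; []; _∷_; lookup; toList; tabulate; here; there)
open import Data.Vec.Properties using (≡-dec; lookup∘tabulate; tabulate∘lookup; tabulate-cong; ∷-injective; []=⇒lookup; lookup⇒[]=)
open import Function using (_∘_; id; _⇔_; mk⇔; Equivalence)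
import Function.Properties.Equivalence as ⇔
open import Relation.Binary.Definitions using (Transitive; tri<; tri≈; tri>)
open import Relation.Binary.PropositionalEquality
  using (_≡_; _≗_; refl; sym; trans; cong; cong₂; subst; subst₂; module ≡-Reasoning)
open import Relation.Nullary using (Dec; yes; no; ¬_; ¬?; _×-dec_; contradiction)
open import Relation.Unary using (Decidable)

module Counting {X : Set} where

  count : {P : X → Set} → Decidable P → List X → ℕ
  count P? xs = length (filter P? xs)

  count-cong : {P Q : X → Set} (P? : Decidable P) (Q? : Decidable Q) →
               (∀ x → P x ⇔ Q x) → ∀ xs → count P? xs ≡ count Q? xs
  count-cong P? Q? P⇔Q xs =
    cong length (filter-≐ P? Q? ((λ {x} → Equivalence.to (P⇔Q x)) , (λ {x} → Equivalence.from (P⇔Q x))) xs)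

  count-split : {P Q : X → Set} (P? : Decidable P) (Q? : Decidable Q) → ∀ xs →
                count P? xs ≡ count (λ x → P? x ×-dec Q? x) xs + count (λ x → P? x ×-dec ¬? (Q? x)) xs
  count-split P? Q? [] = refl
  count-split P? Q? (x ∷ xs) with P? x | Q? x
  ... | no _  | _     = count-split P? Q? xs
  ... | yes _ | yes _ = cong suc (count-split P? Q? xs)
  ... | yes _ | no _  = trans (cong suc (count-split P? Q? xs)) (sym (+-suc _ _))

  count-involution : {P Q : X → Set} (P? : Decidable P) (Q? : Decidable Q) →
    ∀ xs → Unique xs → (ρ : X → X) → (∀ x → ρ (ρ x) ≡ x) →
    (∀ {x} → x ∈ˡ xs → P x → ρ x ∈ˡ xs × Q (ρ x)) →
    (∀ {x} → x ∈ˡ xs → Q x → ρ x ∈ˡ xs × P (ρ x)) →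
    count P? xs ≡ count Q? xs
  count-involution {P} {Q} P? Q? xs xs! ρ ρρ P→Q Q→P =
    trans (↭-length (∼bag⇒↭ (unique∧set⇒bag (Unique.filter⁺ P? xs!) ρQs! (mk⇔ into back))))
          (length-map ρ (filter Q? xs))
    where
    ρ-injective : ∀ {x y} → ρ x ≡ ρ y → x ≡ y
    ρ-injective {x} {y} ρx≡ρy = trans (sym (ρρ x)) (trans (cong ρ ρx≡ρy) (ρρ y))

    ρQs! : Unique (map ρ (filter Q? xs))
    ρQs! = Unique.map⁺ ρ-injective (Unique.filter⁺ Q? xs!)

    into : ∀ {x} → x ∈ˡ filter P? xs → x ∈ˡ map ρ (filter Q? xs)
    into {x} x∈ with x∈xs , Px ← ∈-filter⁻ P? x∈ with ρx∈xs , Qρx ← P→Q x∈xs Px =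
      subst (_∈ˡ map ρ (filter Q? xs)) (ρρ x) (∈-map⁺ ρ (∈-filter⁺ Q? ρx∈xs Qρx))

    back : ∀ {x} → x ∈ˡ map ρ (filter Q? xs) → x ∈ˡ filter P? xs
    back x∈ with y , y∈ , refl ← ∈-map⁻ ρ x∈ with y∈xs , Qy ← ∈-filter⁻ Q? y∈ with ρy∈xs , Pρy ← Q→P y∈xs Qy =
      ∈-filter⁺ P? ρy∈xs Pρy

-- Inclusion–exclusion on the Boolean lattice: two subset-valued statistics on
-- a list that are equidistributed "from below" (same number of x with
-- B ⊆ f x, for every B) are equidistributed exactly.
module Inversion {X : Set} {n : ℕ} (xs : List X) where
  open Counting

  atLeast : (X → Subset n) → Subset n → ℕ
  atLeast f B = count (λ x → B ⊆? f x) xs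

  -- #{x : f x = S}, phrased with the Boolean test of Defs so that count01/count10 are instances
  exactly : (X → Subset n) → Subset n → ℕ
  exactly f S = length (filterᵇ (λ x → f x ≟S S) xs)

  Between : Subset n → List (Fin n) → Subset n → Set
  Between B Z A = B ⊆ A × All (_∉ A) Z

  between? : ∀ B Z A → Dec (Between B Z A)
  between? B Z A = (B ⊆? A) ×-dec all? (λ k → ¬? (k ∈? A)) Z

  between : (X → Subset n) → Subset n → List (Fin n) → ℕ
  between f B Z = count (between? B Z ∘ f) xs

  between-step : ∀ f B k Z → between f B Z ≡ between f (B ∪ ⁅ k ⁆) Z + between f B (k ∷ Z)
  between-step f B k Z = trans (count-split (between? B Z ∘ f) (λ x → k ∈? f x) xs)
    (cong₂ _+_ (count-cong _ _ (λ x → mk⇔ force unforce) xs)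
               (count-cong _ _ (λ x → mk⇔ forbid unforbid) xs))
    where
    force : ∀ {A} → Between B Z A × k ∈ A → Between (B ∪ ⁅ k ⁆) Z A
    force ((B⊆A , Z∉A) , k∈A) = B∪k⊆A , Z∉A
      where
      B∪k⊆A : B ∪ ⁅ k ⁆ ⊆ _
      B∪k⊆A x∈ with x∈p∪q⁻ B ⁅ k ⁆ x∈
      ... | inj₁ x∈B = B⊆A x∈B
      ... | inj₂ x∈k = subst (_∈ _) (sym (x∈⁅y⁆⇒x≡y k x∈k)) k∈A
    unforce : ∀ {A} → Between (B ∪ ⁅ k ⁆) Z A → Between B Z A × k ∈ A
    unforce (B∪k⊆A , Z∉A) = (B∪k⊆A ∘ p⊆p∪q ⁅ k ⁆ , Z∉A) , B∪k⊆A (q⊆p∪q B ⁅ k ⁆ (x∈⁅x⁆ k))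
    forbid : ∀ {A} → Between B Z A × k ∉ A → Between B (k ∷ Z) A
    forbid ((B⊆A , Z∉A) , k∉A) = B⊆A , k∉A ∷ Z∉A
    unforbid : ∀ {A} → Between B (k ∷ Z) A → Between B Z A × k ∉ A
    unforbid (B⊆A , k∉A ∷ Z∉A) = (B⊆A , Z∉A) , k∉A

  between-equal : ∀ f g → (∀ B → atLeast f B ≡ atLeast g B) →
                  ∀ Z B → between f B Z ≡ between g B Z
  between-equal f g same [] B =
    trans (count-cong _ _ (λ x → ⇔.sym (noBound (f x))) xs)
    (trans (same B) (count-cong _ _ (λ x → noBound (g x)) xs))
    where
    noBound : ∀ A → B ⊆ A ⇔ Between B [] A
    noBound A = mk⇔ (_, []) proj₁
  between-equal f g same (k ∷ Z) B = +-cancelˡ-≡ (between f (B ∪ ⁅ k ⁆) Z) _ _ (begin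
    between f (B ∪ ⁅ k ⁆) Z + between f B (k ∷ Z) ≡⟨ sym (between-step f B k Z) ⟩
    between f B Z                                 ≡⟨ between-equal f g same Z B ⟩
    between g B Z                                 ≡⟨ between-step g B k Z ⟩
    between g (B ∪ ⁅ k ⁆) Z + between g B (k ∷ Z) ≡⟨ cong (_+ between g B (k ∷ Z)) (sym (between-equal f g same Z (B ∪ ⁅ k ⁆))) ⟩
    between f (B ∪ ⁅ k ⁆) Z + between g B (k ∷ Z) ∎)
    where open ≡-Reasoning

  elementsOutside : Subset n → List (Fin n)
  elementsOutside S = filter (λ k → ¬? (k ∈? S)) (allFin n)

  equal⇒between : ∀ {A S} → A ≡ S → Between S (elementsOutside S) A
  equal⇒between {S = S} refl = id , All.tabulate (proj₂ ∘ ∈-filter⁻ (λ k → ¬? (k ∈? S)) {xs = allFin n})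

  between⇒equal : ∀ {A S} → Between S (elementsOutside S) A → A ≡ S
  between⇒equal {A} {S} (S⊆A , outside∉A) = ⊆-antisym A⊆S S⊆A
    where
    A⊆S : A ⊆ S
    A⊆S {x} x∈A with x ∈? S
    ... | yes x∈S = x∈S
    ... | no  x∉S = contradiction x∈A (All.lookup outside∉A (∈-filter⁺ (λ k → ¬? (k ∈? S)) (∈-allFin x) x∉S))

  exact⇔between : ∀ A S → T (A ≟S S) ⇔ Between S (elementsOutside S) A
  exact⇔between A S with ≡-dec _≟ᵇ_ A S
  ... | yes A≡S = mk⇔ (λ _ → equal⇒between A≡S) _
  ... | no  A≢S = mk⇔ (λ ()) (A≢S ∘ between⇒equal)

  inversion : ∀ f g → (∀ B → atLeast f B ≡ atLeast g B) → ∀ S → exactly f S ≡ exactly g S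
  inversion f g same S =
    trans (count-cong _ _ (λ x → exact⇔between (f x) S) xs)
    (trans (between-equal f g same (elementsOutside S) S)
           (count-cong _ _ (λ x → ⇔.sym (exact⇔between (g x) S)) xs))

reflect-bounds : ∀ {a j b} → a ≤ j → j ≤ b → a ≤ a + b ∸ j × a + b ∸ j ≤ b
reflect-bounds {a} {j} {b} a≤j j≤b =
  subst (_≤ a + b ∸ j) (m+n∸n≡m a b) (∸-monoʳ-≤ (a + b) j≤b) ,
  subst (a + b ∸ j ≤_) (m+n∸m≡n a b) (∸-monoʳ-≤ (a + b) a≤j)

reflect-involutive : ∀ {a j b} → j ≤ b → a + b ∸ (a + b ∸ j) ≡ j
reflect-involutive {a} {j} {b} j≤b = m∸[m∸n]≡n (≤-trans j≤b (m≤n+m b a))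

reflect-step : ∀ m i → suc i ≤ m → m ∸ i ≡ suc (m ∸ suc i)
reflect-step m i = +-∸-assoc 1

-- Blocks of a Boolean sequence τ vanishing from N on: positions j and j+1 are
-- in the same block exactly when τ j = true.  The block of j is the interval
-- [start j, end j]; σ reverses every block.
module Blocks (τ : ℕ → Bool) (N : ℕ) (τ-vanishes : ∀ m → N ≤ m → τ m ≡ false) where

  IsStart : ℕ → Set
  IsStart zero    = ⊤
  IsStart (suc p) = τ p ≡ false

  start : ℕ → ℕ
  start zero    = zero
  start (suc j) = if τ j then start j else suc j

  endWithin : ℕ → ℕ → ℕ
  endWithin zero    j = j
  endWithin (suc f) j = if τ j then endWithin f (suc j) else j

  -- the last position of the block of j; N steps suffice since τ vanishes from N on
  end : ℕ → ℕ
  end = endWithin N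

  start≤ : ∀ j → start j ≤ j
  start≤ zero = z≤n
  start≤ (suc j) with τ j
  ... | true  = ≤-trans (start≤ j) (n≤1+n j)
  ... | false = ≤-refl

  start-isStart : ∀ j → IsStart (start j)
  start-isStart zero = _
  start-isStart (suc j) with τ j in τj
  ... | true  = start-isStart j
  ... | false = τj

  start-linked : ∀ j m → start j ≤ m → m < j → τ m ≡ true
  start-linked (suc j) m s≤m m<j with τ j in τj
  ... | false = contradiction s≤m (<⇒≱ m<j)
  ... | true with m≤n⇒m<n∨m≡n (≤-pred m<j)
  ...   | inj₁ m<j′ = start-linked j m s≤m m<j′
  ...   | inj₂ refl = τj

  start-unique : ∀ ℓ m → ℓ ≤ m → IsStart ℓ → (∀ k → ℓ ≤ k → k < m → τ k ≡ true) → start m ≡ ℓ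
  start-unique zero    zero    _ _ _ = refl
  start-unique (suc p) zero    () _ _
  start-unique ℓ (suc m) ℓ≤ ℓ-start linked with m≤n⇒m<n∨m≡n ℓ≤
  ... | inj₁ ℓ≤m rewrite linked m (≤-pred ℓ≤m) ≤-refl =
    start-unique ℓ m (≤-pred ℓ≤m) ℓ-start (λ k ℓ≤k k<m → linked k ℓ≤k (≤-trans k<m (n≤1+n m)))
  ... | inj₂ refl rewrite ℓ-start = refl

  ≤endWithin : ∀ f j → j ≤ endWithin f j
  ≤endWithin zero    j = ≤-refl
  ≤endWithin (suc f) j with τ j
  ... | true  = ≤-trans (n≤1+n j) (≤endWithin f (suc j))
  ... | false = ≤-refl

  endWithin-unlinked : ∀ f j → N ≤ f + j → τ (endWithin f j) ≡ false
  endWithin-unlinked zero    j N≤j = τ-vanishes j N≤j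
  endWithin-unlinked (suc f) j N≤ with τ j in τj
  ... | true  = endWithin-unlinked f (suc j) (subst (N ≤_) (sym (+-suc f j)) N≤)
  ... | false = τj

  endWithin-linked : ∀ f j m → j ≤ m → m < endWithin f j → τ m ≡ true
  endWithin-linked zero    j m j≤m m<e = contradiction j≤m (<⇒≱ m<e)
  endWithin-linked (suc f) j m j≤m m<e with τ j in τj
  ... | false = contradiction j≤m (<⇒≱ m<e)
  ... | true with m≤n⇒m<n∨m≡n j≤m
  ...   | inj₁ j<m  = endWithin-linked f (suc j) m j<m m<e
  ...   | inj₂ refl = τj

  ≤end : ∀ j → j ≤ end j
  ≤end = ≤endWithin N

  end-unlinked : ∀ j → τ (end j) ≡ false
  end-unlinked j = endWithin-unlinked N j (m≤m+n N j)

  end-linked : ∀ j m → j ≤ m → m < end j → τ m ≡ true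
  end-linked = endWithin-linked N

  end-least : ∀ j m → j ≤ m → τ m ≡ false → end j ≤ m
  end-least j m j≤m τm = ≮⇒≥ λ m<end → contradiction (trans (sym (end-linked j m j≤m m<end)) τm) λ ()

  end-unique : ∀ j r → j ≤ r → τ r ≡ false → (∀ k → j ≤ k → k < r → τ k ≡ true) → end j ≡ r
  end-unique j r j≤r τr linked = ≤-antisym (end-least j r j≤r τr) (≮⇒≥ λ end<r →
    contradiction (trans (sym (linked (end j) (≤end j) end<r)) (end-unlinked j)) λ ())

  block-linked : ∀ j m → start j ≤ m → m < end j → τ m ≡ true
  block-linked j m s≤m m<e with <-cmp m j
  ... | tri< m<j _ _ = start-linked j m s≤m m<j
  ... | tri≈ _ refl _ = end-linked j m ≤-refl m<e
  ... | tri> _ _ j<m = end-linked j m (<⇒≤ j<m) m<e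

  start-block : ∀ j m → start j ≤ m → m ≤ end j → start m ≡ start j
  start-block j m s≤m m≤e = start-unique (start j) m s≤m (start-isStart j)
    (λ k s≤k k<m → block-linked j k s≤k (<-≤-trans k<m m≤e))

  end-block : ∀ j m → start j ≤ m → m ≤ end j → end m ≡ end j
  end-block j m s≤m m≤e = end-unique m (end j) m≤e (end-unlinked j)
    (λ k m≤k k<e → block-linked j k (≤-trans s≤m m≤k) k<e)

  σ : ℕ → ℕ
  σ j = start j + end j ∸ j

  σ-block : ∀ j → start j ≤ σ j × σ j ≤ end j
  σ-block j = reflect-bounds (start≤ j) (≤end j)

  σ-involutive : ∀ j → σ (σ j) ≡ j
  σ-involutive j
    rewrite start-block j (σ j) (proj₁ (σ-block j)) (proj₂ (σ-block j))
          | end-block j (σ j) (proj₁ (σ-block j)) (proj₂ (σ-block j))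
    = reflect-involutive {start j} (≤end j)

  σ-singleton : ∀ j → start j ≡ end j → σ j ≡ j
  σ-singleton j s≡e = begin
    start j + end j ∸ j ≡⟨ cong (λ s → s + end j ∸ j) (≤-antisym (start≤ j) (subst (j ≤_) (sym s≡e) (≤end j))) ⟩
    j + end j ∸ j       ≡⟨ m+n∸m≡n j (end j) ⟩
    end j               ≡⟨ ≤-antisym (subst (_≤ j) s≡e (start≤ j)) (≤end j) ⟩
    j                   ∎
    where open ≡-Reasoning

  σ-beyond : ∀ j → N < j → σ j ≡ j
  σ-beyond (suc j) (s≤s N≤j) = σ-singleton (suc j) (trans start≡ (sym end≡))
    where
    start≡ : start (suc j) ≡ suc j
    start≡ = start-unique (suc j) (suc j) ≤-refl (τ-vanishes j N≤j) λ k j<k k<j → contradiction j<k (<⇒≱ k<j)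
    end≡ : end (suc j) ≡ suc j
    end≡ = end-unique (suc j) (suc j) ≤-refl (τ-vanishes (suc j) (≤-trans N≤j (n≤1+n j)))
             λ k j≤k k<j → contradiction j≤k (<⇒≱ k<j)

  σ-before : ∀ ℓ t → IsStart ℓ → t < ℓ → σ t < ℓ
  σ-before (suc p) t τp t<ℓ = s≤s (≤-trans (proj₂ (σ-block t)) (end-least t p (≤-pred t<ℓ) τp))

  σ-linked : ∀ i → τ i ≡ true →
             ∃ λ k → σ i ≡ suc k × σ (suc i) ≡ k × start i ≤ k × suc k ≤ end i
  σ-linked i τi = k , σ-i , σ-suc , proj₁ (reflect-bounds s≤i+1 i<e) , subst (_≤ end i) σ-i (proj₂ (σ-block i))
    where
    k : ℕ
    k = start i + end i ∸ suc i
    i<e : i < end i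
    i<e = ≤∧≢⇒< (≤end i) λ i≡e → contradiction (trans (sym τi) (subst (λ m → τ m ≡ false) (sym i≡e) (end-unlinked i))) λ ()
    s≤i+1 : start i ≤ suc i
    s≤i+1 = ≤-trans (start≤ i) (n≤1+n i)
    σ-i : σ i ≡ suc k
    σ-i = reflect-step (start i + end i) i (≤-trans i<e (m≤n+m (end i) (start i)))
    σ-suc : σ (suc i) ≡ k
    σ-suc rewrite start-block i (suc i) s≤i+1 i<e | end-block i (suc i) s≤i+1 i<e = refl

-- Patterns in sequences e : ℕ → ℕ, where position j holds e_{j+1}.

Seen : (ℕ → ℕ) → ℕ → ℕ → Set
Seen e k v = ∃ λ t → t < k × e t ≡ v

-- k+1 ∈ Em*(1 01, e): the sequence rises at k to a value that occurred before k
Em01 : (ℕ → ℕ) → ℕ → Set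
Em01 e k = e k < e (suc k) × Seen e k (e (suc k))

-- k+1 ∈ Em*(1 10, e): the sequence falls at k from a value that occurred before k
Em10 : (ℕ → ℕ) → ℕ → Set
Em10 e k = e (suc k) < e k × Seen e k (e k)

-- e_{j+1} ≤ j at every position (0-indexed form of e_i < i)
IsInversion : (ℕ → ℕ) → Set
IsInversion e = ∀ j → e j ≤ j

Seen-resp : ∀ {e e′ k v} → e ≗ e′ → Seen e k v → Seen e′ k v
Seen-resp e≗e′ (t , t<k , et≡v) = t , t<k , trans (sym (e≗e′ t)) et≡v

Em01-resp : ∀ {e e′ k} → e ≗ e′ → Em01 e k → Em01 e′ k
Em01-resp {k = k} e≗e′ (rise , seen) =
  subst₂ _<_ (e≗e′ k) (e≗e′ (suc k)) rise , subst (Seen _ k) (e≗e′ (suc k)) (Seen-resp e≗e′ seen)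

Em10-resp : ∀ {e e′ k} → e ≗ e′ → Em10 e k → Em10 e′ k
Em10-resp {k = k} e≗e′ (fall , seen) =
  subst₂ _<_ (e≗e′ (suc k)) (e≗e′ k) fall , subst (Seen _ k) (e≗e′ k) (Seen-resp e≗e′ seen)

IsInversion-resp : ∀ {e e′} → e ≗ e′ → IsInversion e → IsInversion e′
IsInversion-resp e≗e′ inv j = subst (_≤ j) (e≗e′ j) (inv j)

seen-small : ∀ {e a v} → IsInversion e → Seen e a v → v < a
seen-small inv (t , t<a , et≡v) = subst (_< _) et≡v (≤-<-trans (inv t) t<a)

module Run {_≺_ : ℕ → ℕ → Set} (≺-trans : Transitive _≺_) (e : ℕ → ℕ) (a b : ℕ)
           (step : ∀ k → a ≤ k → k < b → e k ≺ e (suc k)) where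

  chain : ∀ p q → a ≤ p → p < q → q ≤ b → e p ≺ e q
  chain p (suc q) a≤p p<q+1 q+1≤b with m≤n⇒m<n∨m≡n (≤-pred p<q+1)
  ... | inj₁ p<q  = ≺-trans (chain p q a≤p p<q (≤-trans (n≤1+n q) q+1≤b)) (step q (≤-trans a≤p (<⇒≤ p<q)) q+1≤b)
  ... | inj₂ refl = step p a≤p q+1≤b

  repeat-before : (∀ {x} → ¬ x ≺ x) → ∀ t q → t < q → q ≤ b → e t ≡ e q → t < a
  repeat-before ≺-irrefl t q t<q q≤b et≡eq with t <? a
  ... | yes t<a = t<a
  ... | no  t≮a = contradiction (subst (_≺ e q) et≡eq (chain t q (≮⇒≥ t≮a) t<q q≤b)) ≺-irrefl

module Reversal (τ : ℕ → Bool) (N : ℕ) (τ-vanishes : ∀ m → N ≤ m → τ m ≡ false) where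
  open Blocks τ N τ-vanishes

  Em01On : (ℕ → ℕ) → Set
  Em01On e = ∀ k → τ k ≡ true → Em01 e k

  Em10On : (ℕ → ℕ) → Set
  Em10On e = ∀ k → τ k ≡ true → Em10 e k

  reversed-seen : ∀ e i v → Seen e (start i) v → Seen (e ∘ σ) i v
  reversed-seen e i v (t , t<s , et≡v) =
    σ t , ≤-trans (σ-before (start i) t (start-isStart i) t<s) (start≤ i) , trans (cong e (σ-involutive t)) et≡v

  BlockValuesSmall : (ℕ → ℕ) → Set
  BlockValuesSmall e = ∀ j → start j < end j → ∀ m → start j ≤ m → m ≤ end j → e m < start j

  reversed-inversion : ∀ e → IsInversion e → BlockValuesSmall e → IsInversion (e ∘ σ)
  reversed-inversion e inv small j with m≤n⇒m<n∨m≡n (≤-trans (start≤ j) (≤end j))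
  ... | inj₁ s<e = <⇒≤ (<-≤-trans (small j s<e (σ j) (proj₁ (σ-block j)) (proj₂ (σ-block j))) (start≤ j))
  ... | inj₂ s≡e = subst (λ m → e m ≤ j) (sym (σ-singleton j s≡e)) (inv j)

  module FromEm01 (e : ℕ → ℕ) (em : Em01On e) where

    rising : ∀ j k → start j ≤ k → k < end j → e k < e (suc k)
    rising j k s≤k k<e = proj₁ (em k (block-linked j k s≤k k<e))

    repeat-before-block : ∀ j t q → t < q → q ≤ end j → e t ≡ e q → t < start j
    repeat-before-block j = Run.repeat-before <-trans e (start j) (end j) (rising j) (λ {x} → n≮n x)

    seen-before-block : ∀ j q → start j < q → q ≤ end j → Seen e (start j) (e q)
    seen-before-block j (suc k) s<k+1 k+1≤e with em k (block-linked j k (≤-pred s<k+1) k+1≤e)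
    ... | _ , t , t<k , et≡ = t , repeat-before-block j t (suc k) (≤-trans t<k (n≤1+n k)) k+1≤e et≡ , et≡

    -- the first value of a block is below the second, hence below the block start as well

    values-small : IsInversion e → BlockValuesSmall e
    values-small inv j s<e m s≤m m≤e with m≤n⇒m<n∨m≡n s≤m
    ... | inj₁ s<m  = seen-small inv (seen-before-block j m s<m m≤e)
    ... | inj₂ refl = <-trans (rising j (start j) ≤-refl s<e) (seen-small inv (seen-before-block j (suc (start j)) ≤-refl s<e))

    -- the step i, i+1 of e ∘ σ is the step k+1, k of e read backwards
    reversed : Em10On (e ∘ σ)
    reversed i τi with σ-linked i τi
    ... | k , σi≡ , σi+1≡ , s≤k , k+1≤e rewrite σi≡ | σi+1≡ =
      rising i k s≤k k+1≤e , reversed-seen e i (e (suc k)) (seen-before-block i (suc k) (s≤s s≤k) k+1≤e)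

  module FromEm10 (e : ℕ → ℕ) (em : Em10On e) where

    falling : ∀ j k → start j ≤ k → k < end j → e (suc k) < e k
    falling j k s≤k k<e = proj₁ (em k (block-linked j k s≤k k<e))

    repeat-before-block : ∀ j t q → t < q → q ≤ end j → e t ≡ e q → t < start j
    repeat-before-block j = Run.repeat-before (λ x>y y>z → <-trans y>z x>y) e (start j) (end j) (falling j) (λ {x} → n≮n x)

    seen-before-block : ∀ j k → start j ≤ k → k < end j → Seen e (start j) (e k)
    seen-before-block j k s≤k k<e with em k (block-linked j k s≤k k<e)
    ... | _ , t , t<k , et≡ = t , repeat-before-block j t k t<k (<⇒≤ k<e) et≡ , et≡

    -- the last value of a block is below the one before it, hence below the block start as well

    values-small : IsInversion e → BlockValuesSmall e
    values-small inv j s<e m s≤m m≤e with m≤n⇒m<n∨m≡n m≤e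
    ... | inj₁ m<e = seen-small inv (seen-before-block j m s≤m m<e)
    ... | inj₂ m≡e = last-small m (subst (start j <_) (sym m≡e) s<e) m≤e
      where
      last-small : ∀ q → start j < q → q ≤ end j → e q < start j
      last-small (suc k) s<k+1 k+1≤e =
        <-trans (falling j k (≤-pred s<k+1) k+1≤e) (seen-small inv (seen-before-block j k (≤-pred s<k+1) k+1≤e))

    -- the step i, i+1 of e ∘ σ is the step k+1, k of e read backwards
    reversed : Em01On (e ∘ σ)
    reversed i τi with σ-linked i τi
    ... | k , σi≡ , σi+1≡ , s≤k , k+1≤e rewrite σi≡ | σi+1≡ =
      falling i k s≤k k+1≤e , reversed-seen e i (e k) (seen-before-block i k s≤k k+1≤e)

-- a vector read as a sequence ℕ → ℕ, which is 0 beyond its length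
E : ∀ {n} → Vec ℕ n → ℕ → ℕ
E v = at (toList v)

E-lookup : ∀ {n} (v : Vec ℕ n) (K : Fin n) → E v (toℕ K) ≡ lookup v K
E-lookup (x ∷ v) zero    = refl
E-lookup (x ∷ v) (suc K) = E-lookup v K

E-beyond : ∀ {n} (v : Vec ℕ n) j → n ≤ j → E v j ≡ 0
E-beyond []      j       _         = refl
E-beyond (x ∷ v) (suc j) (s≤s n≤j) = E-beyond v j n≤j

isInvL-sound : ∀ s l → T (isInvL s l) → ∀ j → at l j ≤ s + j
isInvL-sound s []      _ j = z≤n
isInvL-sound s (x ∷ l) ok zero = subst (x ≤_) (sym (+-identityʳ s)) (≤-pred (<ᵇ⇒< x (suc s) (proj₁ (Equivalence.to T-∧ ok))))
isInvL-sound s (x ∷ l) ok (suc j) = subst (at l j ≤_) (sym (+-suc s j)) (isInvL-sound (suc s) l (proj₂ (Equivalence.to T-∧ ok)) j)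

isInvL-complete : ∀ s l → (∀ j → at l j ≤ s + j) → T (isInvL s l)
isInvL-complete s []      _     = _
isInvL-complete s (x ∷ l) bound = Equivalence.from T-∧
  ( <⇒<ᵇ (s≤s (subst (x ≤_) (+-identityʳ s) (bound zero)))
  , isInvL-complete (suc s) l (λ j → subst (at l j ≤_) (+-suc s j) (bound (suc j))))

isInv⇔ : ∀ {n} (v : Vec ℕ n) → T (isInv v) ⇔ IsInversion (E v)
isInv⇔ v = mk⇔ (isInvL-sound 0 (toList v)) (isInvL-complete 0 (toList v))

any-seen⇔ : ∀ e k v → T (any (λ t → e t ≡ᵇ v) (upTo k)) ⇔ Seen e k v
any-seen⇔ e k v = mk⇔ sound complete
  where
  sound : T (any (λ t → e t ≡ᵇ v) (upTo k)) → Seen e k v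
  sound found with t , t∈ , et≡ᵇv ← find (any⁻ _ (upTo k) found) = t , ∈-upTo⁻ t∈ , ≡ᵇ⇒≡ (e t) v et≡ᵇv
  complete : Seen e k v → T (any (λ t → e t ≡ᵇ v) (upTo k))
  complete (t , t<k , et≡v) = any⁺ _ (lose (∈-upTo⁺ t<k) (≡⇒≡ᵇ (e t) v et≡v))

-- the Boolean test shared by em01 and em10: position j+1 < n, the pair of
-- neighbours lo < hi, and hi occurred before j
pattern-bit⇔ : ∀ n e j lo hi →
  T ((suc j <ᵇ n) ∧ (lo <ᵇ hi) ∧ any (λ t → e t ≡ᵇ hi) (upTo j)) ⇔ (suc j < n × lo < hi × Seen e j hi)
pattern-bit⇔ n e j lo hi = mk⇔
  (λ bit → let inside , rest = Equivalence.to T-∧ bit ; rise , seen = Equivalence.to T-∧ rest in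
     <ᵇ⇒< (suc j) n inside , <ᵇ⇒< lo hi rise , Equivalence.to (any-seen⇔ e j hi) seen)
  (λ (j+1<n , lo<hi , seen) → Equivalence.from T-∧ (<⇒<ᵇ j+1<n ,
     Equivalence.from T-∧ (<⇒<ᵇ lo<hi , Equivalence.from (any-seen⇔ e j hi) seen)))

∈-tabulate⇔ : ∀ {n} (g : Fin n → Bool) K → K ∈ tabulate g ⇔ T (g K)
∈-tabulate⇔ g K = mk⇔
  (λ K∈ → Equivalence.from T-≡ (trans (sym (lookup∘tabulate g K)) ([]=⇒lookup K∈)))
  (λ gK → lookup⇒[]= K (tabulate g) (trans (lookup∘tabulate g K) (Equivalence.to T-≡ gK)))

Characterises : ∀ {n} → Subset n → (ℕ → Set) → Set
Characterises {n} A P = ∀ K → K ∈ A ⇔ (suc (toℕ K) < n × P (toℕ K))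

em01-char : ∀ {n} (v : Vec ℕ n) → Characterises (em01 v) (Em01 (E v))
em01-char {n} v K = ⇔.trans (∈-tabulate⇔ _ K) (pattern-bit⇔ n (E v) (toℕ K) _ _)

em10-char : ∀ {n} (v : Vec ℕ n) → Characterises (em10 v) (Em10 (E v))
em10-char {n} v K = ⇔.trans (∈-tabulate⇔ _ K) (pattern-bit⇔ n (E v) (toℕ K) _ _)

-- linked B j: the element j+1 of [n] is in B and j+1 < n, so that positions
-- j and j+1 both exist and B links them (B is encoded 0-indexed, as in Defs)
linked : ∀ {n} → Subset n → ℕ → Bool
linked []          j       = false
linked (x ∷ [])    j       = false
linked (x ∷ y ∷ B) zero    = x
linked (x ∷ y ∷ B) (suc j) = linked (y ∷ B) j

linked-vanishes : ∀ {N} (B : Subset (suc N)) m → N ≤ m → linked B m ≡ false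
linked-vanishes (x ∷ [])    m       _         = refl
linked-vanishes (x ∷ y ∷ B) (suc m) (s≤s N≤m) = linked-vanishes (y ∷ B) m N≤m

linked-index : ∀ {n} (B : Subset n) j → linked B j ≡ true → ∃ λ (K : Fin n) → toℕ K ≡ j
linked-index (x ∷ y ∷ B) zero    _ = zero , refl
linked-index (x ∷ y ∷ B) (suc j) l with K , refl ← linked-index (y ∷ B) j l = suc K , refl

linked⇔ : ∀ {n} (B : Subset n) K → linked B (toℕ K) ≡ true ⇔ (K ∈ B × suc (toℕ K) < n)
linked⇔ B K = mk⇔ (sound B K) (λ (K∈B , K+1<n) → complete B K K∈B K+1<n)
  where
  sound : ∀ {n} (B : Subset n) K → linked B (toℕ K) ≡ true → K ∈ B × suc (toℕ K) < n
  sound (true ∷ y ∷ B) zero    _ = here , s≤s (s≤s z≤n)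
  sound (x ∷ y ∷ B)    (suc K) l = let K∈B , K+1<n = sound (y ∷ B) K l in there K∈B , s≤s K+1<n
  sound (x ∷ [])       zero    ()
  complete : ∀ {n} (B : Subset n) K → K ∈ B → suc (toℕ K) < n → linked B (toℕ K) ≡ true
  complete (x ∷ y ∷ B) zero    here      _         = refl
  complete (x ∷ y ∷ B) (suc K) (there K∈B) (s≤s K+1<n) = complete (y ∷ B) K K∈B K+1<n
  complete (x ∷ [])    zero    _         (s≤s ())

module PatternSet {n} {A : Subset n} (P : ℕ → Set) (char : Characterises A P) (B : Subset n) where

  ⊆-proper : B ⊆ A → ∀ {K} → K ∈ B → suc (toℕ K) < n
  ⊆-proper B⊆A K∈B = proj₁ (Equivalence.to (char _) (B⊆A K∈B))

  ⊆-linked : B ⊆ A → ∀ j → linked B j ≡ true → P j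
  ⊆-linked B⊆A j l with K , refl ← linked-index B j l =
    proj₂ (Equivalence.to (char K) (B⊆A (proj₁ (Equivalence.to (linked⇔ B K) l))))

  linked-⊆ : (∀ {K} → K ∈ B → suc (toℕ K) < n) → (∀ j → linked B j ≡ true → P j) → B ⊆ A
  linked-⊆ proper holds {K} K∈B =
    Equivalence.from (char K) (proper K∈B , holds (toℕ K) (Equivalence.from (linked⇔ B K) (K∈B , proper K∈B)))

concatMap-product : ∀ {A B C : Set} (f : A → B → C) xs ys →
                    concatMap (λ x → map (f x) ys) xs ≡ cartesianProductWith f xs ys
concatMap-product f []       ys = refl
concatMap-product f (x ∷ xs) ys = cong (map (f x) ys ++_) (concatMap-product f xs ys)

allVecs-unique : ∀ n b → Unique (allVecs n b)
allVecs-unique zero    b = [] ∷ []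
allVecs-unique (suc n) b = subst Unique (sym (concatMap-product _∷_ (upTo b) (allVecs n b)))
  (Unique.cartesianProductWith⁺ _∷_ ∷-injective (Unique.upTo⁺ b) (allVecs-unique n b))

allVecs-complete : ∀ n b (v : Vec ℕ n) → (∀ K → lookup v K < b) → v ∈ˡ allVecs n b
allVecs-complete zero    b []      _       = Any.here refl
allVecs-complete (suc n) b (x ∷ v) bounded = subst (_ ∈ˡ_) (sym (concatMap-product _∷_ (upTo b) (allVecs n b)))
  (∈-cartesianProductWith⁺ _∷_ (∈-upTo⁺ (bounded zero)) (allVecs-complete n b v (bounded ∘ suc)))

Inv-unique : ∀ n → Unique (Inv n)
Inv-unique n = Unique.filter⁺ (T? ∘ isInv) (allVecs-unique n n)

Inv-sound : ∀ {n} {v : Vec ℕ n} → v ∈ˡ Inv n → IsInversion (E v)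
Inv-sound {n} {v} v∈ = Equivalence.to (isInv⇔ v) (proj₂ (∈-filter⁻ (T? ∘ isInv) {xs = allVecs n n} v∈))

Inv-complete : ∀ {n} (v : Vec ℕ n) → IsInversion (E v) → v ∈ˡ Inv n
Inv-complete {n} v inv = ∈-filter⁺ (T? ∘ isInv) (allVecs-complete n n v entry<n) (Equivalence.from (isInv⇔ v) inv)
  where
  entry<n : ∀ K → lookup v K < n
  entry<n K = subst (_< n) (E-lookup v K) (≤-<-trans (inv (toℕ K)) (toℕ<n K))

module BlockReversal (N : ℕ) (B : Subset (suc N)) where
  open Blocks (linked B) N (linked-vanishes B)
  open Reversal (linked B) N (linked-vanishes B)

  ρ : Vec ℕ (suc N) → Vec ℕ (suc N)
  ρ v = tabulate (λ K → E v (σ (toℕ K)))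

  E-ρ : ∀ v j → E (ρ v) j ≡ E v (σ j)
  E-ρ v j with j <? suc N
  ... | yes j<n = begin
    E (ρ v) j                        ≡⟨ cong (E (ρ v)) (sym (toℕ-fromℕ< j<n)) ⟩
    E (ρ v) (toℕ (fromℕ< j<n))       ≡⟨ E-lookup (ρ v) (fromℕ< j<n) ⟩
    lookup (ρ v) (fromℕ< j<n)        ≡⟨ lookup∘tabulate (λ K → E v (σ (toℕ K))) (fromℕ< j<n) ⟩
    E v (σ (toℕ (fromℕ< j<n)))       ≡⟨ cong (E v ∘ σ) (toℕ-fromℕ< j<n) ⟩
    E v (σ j)                        ∎
    where open ≡-Reasoning
  ... | no j≮n = begin
    E (ρ v) j                        ≡⟨ E-beyond (ρ v) j (≮⇒≥ j≮n) ⟩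
    0                                ≡⟨ sym (E-beyond v j (≮⇒≥ j≮n)) ⟩
    E v j                            ≡⟨ cong (E v) (sym (σ-beyond j (≮⇒≥ j≮n))) ⟩
    E v (σ j)                        ∎
    where open ≡-Reasoning

  ρ-involutive : ∀ v → ρ (ρ v) ≡ v
  ρ-involutive v = trans (tabulate-cong entry) (tabulate∘lookup v)
    where
    entry : ∀ K → E (ρ v) (σ (toℕ K)) ≡ lookup v K
    entry K = trans (E-ρ v (σ (toℕ K))) (trans (cong (E v) (σ-involutive (toℕ K))) (E-lookup v K))

  ρ-reads : ∀ v → E v ∘ σ ≗ E (ρ v)
  ρ-reads v j = sym (E-ρ v j)

  module Em01Set (v : Vec ℕ (suc N)) = PatternSet (Em01 (E v)) (em01-char v) B
  module Em10Set (v : Vec ℕ (suc N)) = PatternSet (Em10 (E v)) (em10-char v) B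

  ρ-01→10 : ∀ {v} → v ∈ˡ Inv (suc N) → B ⊆ em01 v → ρ v ∈ˡ Inv (suc N) × B ⊆ em10 (ρ v)
  ρ-01→10 {v} v∈ B⊆ =
    Inv-complete (ρ v) (IsInversion-resp (ρ-reads v) (reversed-inversion (E v) inv (values-small inv))) ,
    Em10Set.linked-⊆ (ρ v) (Em01Set.⊆-proper v B⊆) (λ j l → Em10-resp (ρ-reads v) (reversed j l))
    where
    inv : IsInversion (E v)
    inv = Inv-sound v∈
    open FromEm01 (E v) (Em01Set.⊆-linked v B⊆)

  ρ-10→01 : ∀ {v} → v ∈ˡ Inv (suc N) → B ⊆ em10 v → ρ v ∈ˡ Inv (suc N) × B ⊆ em01 (ρ v)
  ρ-10→01 {v} v∈ B⊆ =
    Inv-complete (ρ v) (IsInversion-resp (ρ-reads v) (reversed-inversion (E v) inv (values-small inv))) ,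
    Em01Set.linked-⊆ (ρ v) (Em10Set.⊆-proper v B⊆) (λ j l → Em01-resp (ρ-reads v) (reversed j l))
    where
    inv : IsInversion (E v)
    inv = Inv-sound v∈
    open FromEm10 (E v) (Em10Set.⊆-linked v B⊆)

  open Inversion {n = suc N} (Inv (suc N)) using (atLeast)

  atLeast-equal : atLeast em01 B ≡ atLeast em10 B
  atLeast-equal = Counting.count-involution (λ v → B ⊆? em01 v) (λ v → B ⊆? em10 v)
    (Inv (suc N)) (Inv-unique (suc N)) ρ ρ-involutive ρ-01→10 ρ-10→01

proposition3p6 : (n : ℕ) → 1 ≤ n → (S : Subset n) → count01 n S ≡ count10 n S
proposition3p6 (suc N) (s≤s z≤n) =
  Inversion.inversion {n = suc N} (Inv (suc N)) em01 em10 (BlockReversal.atLeast-equal N)
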